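{- Let $n,m\in\mathbb{N}$ with $n\leq m$. There exists a digraph $G$ such that $cic(G)=m$ and $\kappa(G)=n$, where $cic(G)$ is the number of directed cycles of $G$.
   Context: A kernel of a digraph $D$ is a set $N\subseteq V(D)$ that is independent (no arc between two vertices of $N$) and absorbent (for every $u\in V(D)\setminus N$ there is $v\in N$ with $(u,v)\in A(D)$). Subdividing an arc $(u,v)$ means replacing it by a new vertex $a$ and the arcs $(u,a),(a,v)$. For $\Lambda\subseteq A(D)$, $D_\Lambda$ is obtained from $D$ by subdividing every arc of $\Lambda$. $\kappa(D)$ is the smallest cardinality of $\Lambda\subseteq A(D)$ such that $D_\Lambda$ has a kernel. -}

module Defs where

open import Data.Nat using (ℕ; _≤_)
open import Data.Nat.ListAction using (sum)
open import Data.Fin using (Fin; toℕ)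
open import Data.Bool using (Bool; true; false; if_then_else_)
open import Data.List using (List; []; _∷_; _++_; [_]; map; length; allFin)
open import Data.List.Relation.Unary.All using (All)
open import Data.List.Relation.Unary.Unique.Propositional using (Unique)
open import Data.List.Membership.Propositional using (_∈_)
open import Data.Product using (Σ; Σ-syntax; _×_; _,_)
open import Data.Sum using (_⊎_; inj₁; inj₂)
open import Data.Unit using (⊤)
open import Data.Empty using (⊥)
open import Relation.Binary.PropositionalEquality using (_≡_)
open import Relation.Nullary using (¬_)

record Digraph : Set where
  field
    V        : ℕ
    arc      : Fin V → Fin V → Bool
    loopless : ∀ v → arc v v ≡ false
open Digraph public

IsKernel : {X : Set} → (X → X → Set) → (X → Bool) → Set
IsKernel {X} A N =
  (∀ x y → N x ≡ true → N y ≡ true → ¬ A x y)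
  × (∀ x → N x ≡ false → Σ[ y ∈ X ] (N y ≡ true × A x y))

HasKernel : {X : Set} → (X → X → Set) → Set
HasKernel {X} A = Σ[ N ∈ (X → Bool) ] IsKernel A N

ArcSubset : Digraph → Set
ArcSubset D = Fin (V D) → Fin (V D) → Bool

SubsetOfArcs : (D : Digraph) → ArcSubset D → Set
SubsetOfArcs D Λ = ∀ u v → Λ u v ≡ true → arc D u v ≡ true

card : {D : Digraph} → ArcSubset D → ℕ
card {D} Λ = sum (map (λ u → sum (map (λ v → if Λ u v then 1 else 0) (allFin (V D)))) (allFin (V D)))

-- Vertices of D_Λ: old vertices, plus one new vertex per arc of Λ.
SubVertex : (D : Digraph) → ArcSubset D → Set
SubVertex D Λ = Fin (V D) ⊎ (Σ[ e ∈ Fin (V D) × Fin (V D) ] (Λ (Data.Product.proj₁ e) (Data.Product.proj₂ e) ≡ true))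

SubArc : (D : Digraph) (Λ : ArcSubset D) → SubVertex D Λ → SubVertex D Λ → Set
SubArc D Λ (inj₁ u) (inj₁ v) = (arc D u v ≡ true) × (Λ u v ≡ false)
SubArc D Λ (inj₁ u) (inj₂ ((u' , _) , _)) = u ≡ u'
SubArc D Λ (inj₂ ((_ , v) , _)) (inj₁ w) = v ≡ w
SubArc D Λ (inj₂ _) (inj₂ _) = ⊥

KappaIs : Digraph → ℕ → Set
KappaIs D n =
  (Σ[ Λ ∈ ArcSubset D ] (SubsetOfArcs D Λ × card {D} Λ ≡ n × HasKernel (SubArc D Λ)))
  × (∀ (Λ : ArcSubset D) → SubsetOfArcs D Λ → HasKernel (SubArc D Λ) → n ≤ card {D} Λ)

-- A directed cycle is represented canonically by the
-- list of its (distinct) vertices v0 v1 … v(k-1) in cyclic order, starting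
-- at the vertex of least index (this fixes the rotation), with arcs
-- v0→v1→…→v(k-1)→v0.

Walk : (D : Digraph) → List (Fin (V D)) → Set
Walk D [] = ⊤
Walk D (x ∷ []) = ⊤
Walk D (x ∷ y ∷ r) = (arc D x y ≡ true) × Walk D (y ∷ r)

IsCycle : (D : Digraph) → List (Fin (V D)) → Set
IsCycle D [] = ⊥
IsCycle D (v0 ∷ rest) =
  Unique (v0 ∷ rest) × Walk D (v0 ∷ rest ++ [ v0 ]) × All (λ w → toℕ v0 ≤ toℕ w) rest

CicIs : Digraph → ℕ → Set
CicIs D m = Σ[ L ∈ List (List (Fin (V D))) ]
  (Unique L × All (IsCycle D) L × (∀ c → IsCycle D c → c ∈ L) × length L ≡ m)

-- Take the disjoint union of n directed triangles and m − n digons.  Every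
-- directed cycle lies inside one gadget, so there are exactly m of them.  A
-- digon has a kernel and a triangle gets one as soon as one of its arcs is
-- subdivided, so n subdivisions suffice; conversely a triangle none of whose
-- arcs is subdivided has no kernel (each vertex would have to be absorbed by
-- its unique successor, which is impossible around an odd cycle), and kernels
-- restrict to the remaining gadgets, so n subdivisions are also necessary.
module Submission where

open import Defs
open import Data.Bool using (Bool; true; false; not; if_then_else_)
open import Data.Empty using (⊥; ⊥-elim)
open import Data.Fin using (Fin; zero; suc)
open import Data.List using (List; []; _∷_; _++_; [_]; map; tabulate)
open import Data.List.Membership.Propositional using (_∈_)
open import Data.List.Membership.Propositional.Properties using (∈-map⁺)
open import Data.List.Properties using (map-++; map-tabulate; tabulate-cong; length-map; map-injective)
open import Data.List.Relation.Unary.All as All using (All; []; _∷_)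
import Data.List.Relation.Unary.All.Properties as All
open import Data.List.Relation.Unary.AllPairs using ([]; _∷_)
open import Data.List.Relation.Unary.Any using (here; there)
import Data.List.Relation.Unary.Unique.Propositional.Properties as Unique
open import Data.Nat using (ℕ; zero; suc; _+_; _∸_; _≤_; z≤n; s≤s; s≤s⁻¹)
open import Data.Nat.ListAction using (sum)
open import Data.Nat.Properties using (≤-trans; +-mono-≤; +-monoʳ-≤; m≤m+n; m≤n+m; +-assoc; +-identityʳ; m+[n∸m]≡n; module ≤-Reasoning)
open import Data.Product using (Σ-syntax; ∃-syntax; _×_; _,_)
open import Data.Sum using (_⊎_; inj₁; inj₂)
open import Data.Unit using (⊤; tt)
open import Relation.Binary.PropositionalEquality using (_≡_; _≢_; refl; sym; trans; cong; subst; module ≡-Reasoning)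
open import Relation.Nullary using (¬_)
open import Function using (_∋_; id)

pattern v₀ = zero
pattern v₁ = suc zero
pattern v₂ = suc (suc zero)
pattern ↑ u = suc (suc (suc u))

↑-injective : ∀ {n} {u w : Fin n} → (Fin (3 + n) ∋ ↑ u) ≡ ↑ w → u ≡ w
↑-injective refl = refl

-- extend true D is D plus a disjoint directed triangle v₀ → v₁ → v₂ → v₀,
-- extend false D is D plus a disjoint digon v₀ ⇄ v₁ and an isolated vertex v₂;
-- the vertices of D are shifted to ↑ u.
extendArc : Bool → (D : Digraph) → Fin (3 + V D) → Fin (3 + V D) → Bool
extendArc b D v₀ v₁ = true
extendArc b D v₁ v₂ = b
extendArc b D v₁ v₀ = not b
extendArc b D v₂ v₀ = b
extendArc b D (↑ u) (↑ v) = arc D u v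
extendArc b D _ _ = false

extendArc-loopless : ∀ b D v → extendArc b D v v ≡ false
extendArc-loopless b D v₀ = refl
extendArc-loopless b D v₁ = refl
extendArc-loopless b D v₂ = refl
extendArc-loopless b D (↑ u) = loopless D u

extend : Bool → Digraph → Digraph
extend b D = record { V = 3 + V D ; arc = extendArc b D ; loopless = extendArc-loopless b D }

emptyDigraph : Digraph
emptyDigraph = record { V = 0 ; arc = λ () ; loopless = λ () }

gadgets : ℕ → ℕ → Digraph
gadgets zero zero = emptyDigraph
gadgets zero (suc k) = extend false (gadgets zero k)
gadgets (suc t) k = extend true (gadgets t k)

gadgetCycle : ∀ {n} → Bool → List (Fin (3 + n))
gadgetCycle true = v₀ ∷ v₁ ∷ v₂ ∷ []
gadgetCycle false = v₀ ∷ v₁ ∷ []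

gadgetCycle-isCycle : ∀ b D → IsCycle (extend b D) (gadgetCycle b)
gadgetCycle-isCycle true D =
  ((λ ()) ∷ (λ ()) ∷ []) ∷ ((λ ()) ∷ []) ∷ [] ∷ [] , (refl , refl , refl , tt) , z≤n ∷ z≤n ∷ []
gadgetCycle-isCycle false D = ((λ ()) ∷ []) ∷ [] ∷ [] , (refl , refl , tt) , z≤n ∷ []

gadgetCycle≢map-↑ : ∀ {n} b (c : List (Fin n)) → gadgetCycle b ≢ map ↑ c
gadgetCycle≢map-↑ true [] ()
gadgetCycle≢map-↑ true (_ ∷ _) ()
gadgetCycle≢map-↑ false [] ()
gadgetCycle≢map-↑ false (_ ∷ _) ()

module _ (b : Bool) (D : Digraph) where

  Walk-↑⁺ : ∀ xs → Walk D xs → Walk (extend b D) (map ↑ xs)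
  Walk-↑⁺ [] _ = tt
  Walk-↑⁺ (x ∷ []) _ = tt
  Walk-↑⁺ (x ∷ y ∷ r) (xy , w) = xy , Walk-↑⁺ (y ∷ r) w

  Walk-↑⁻ : ∀ xs → Walk (extend b D) (map ↑ xs) → Walk D xs
  Walk-↑⁻ [] _ = tt
  Walk-↑⁻ (x ∷ []) _ = tt
  Walk-↑⁻ (x ∷ y ∷ r) (xy , w) = xy , Walk-↑⁻ (y ∷ r) w

  IsCycle-↑⁺ : ∀ c → IsCycle D c → IsCycle (extend b D) (map ↑ c)
  IsCycle-↑⁺ (v ∷ rest) (unique , walk , least) =
    Unique.map⁺ ↑-injective unique ,
    subst (Walk (extend b D)) (cong (↑ v ∷_) (map-++ ↑ rest [ v ])) (Walk-↑⁺ (v ∷ rest ++ [ v ]) walk) ,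
    All.map⁺ (All.map (λ v≤w → s≤s (s≤s (s≤s v≤w))) least)

  IsCycle-↑⁻ : ∀ v rest → IsCycle (extend b D) (↑ v ∷ map ↑ rest) → IsCycle D (v ∷ rest)
  IsCycle-↑⁻ v rest (unique , walk , least) =
    Unique.map⁻ unique ,
    Walk-↑⁻ (v ∷ rest ++ [ v ]) (subst (Walk (extend b D)) (sym (cong (↑ v ∷_) (map-++ ↑ rest [ v ]))) walk) ,
    All.map (λ v≤w → s≤s⁻¹ (s≤s⁻¹ (s≤s⁻¹ v≤w))) (All.map⁻ least)

  IsOld : Fin (3 + V D) → Set
  IsOld y = Σ[ u ∈ Fin (V D) ] y ≡ ↑ u

  Walk-from-old : ∀ u xs → Walk (extend b D) (↑ u ∷ xs) → All IsOld xs
  Walk-from-old u [] _ = []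
  Walk-from-old u (v₀ ∷ _) (() , _)
  Walk-from-old u (v₁ ∷ _) (() , _)
  Walk-from-old u (v₂ ∷ _) (() , _)
  Walk-from-old u (↑ y ∷ r) (_ , w) = (y , refl) ∷ Walk-from-old y r w

  All-IsOld⇒map-↑ : ∀ xs → All IsOld xs → ∃[ xs′ ] xs ≡ map ↑ xs′
  All-IsOld⇒map-↑ [] [] = [] , refl
  All-IsOld⇒map-↑ (_ ∷ xs) ((y , refl) ∷ old) with All-IsOld⇒map-↑ xs old
  ... | xs′ , refl = y ∷ xs′ , refl

IsNew : ∀ {n} → Fin (3 + n) → Set
IsNew (↑ _) = ⊥
IsNew _ = ⊤

triangle-only-cycle : ∀ D v rest → IsNew v → IsCycle (extend true D) (v ∷ rest) → v ∷ rest ≡ gadgetCycle true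
triangle-only-cycle D v₀ (v₁ ∷ v₂ ∷ []) _ _ = refl
triangle-only-cycle D v₀ (v₁ ∷ v₂ ∷ v₀ ∷ _) _ ((_ ∷ _ ∷ v₀≢v₀ ∷ _) ∷ _ , _) = ⊥-elim (v₀≢v₀ refl)
triangle-only-cycle D v₀ (v₁ ∷ v₂ ∷ v₁ ∷ _) _ (_ , (_ , _ , () , _) , _)
triangle-only-cycle D v₀ (v₁ ∷ v₂ ∷ v₂ ∷ _) _ (_ , (_ , _ , () , _) , _)
triangle-only-cycle D v₀ (v₁ ∷ v₂ ∷ ↑ _ ∷ _) _ (_ , (_ , _ , () , _) , _)
triangle-only-cycle D v₀ (v₁ ∷ []) _ (_ , (_ , () , _) , _)
triangle-only-cycle D v₀ (v₁ ∷ v₀ ∷ _) _ (_ , (_ , () , _) , _)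
triangle-only-cycle D v₀ (v₁ ∷ v₁ ∷ _) _ (_ , (_ , () , _) , _)
triangle-only-cycle D v₀ (v₁ ∷ ↑ _ ∷ _) _ (_ , (_ , () , _) , _)
triangle-only-cycle D v₀ [] _ (_ , (() , _) , _)
triangle-only-cycle D v₀ (v₀ ∷ _) _ (_ , (() , _) , _)
triangle-only-cycle D v₀ (v₂ ∷ _) _ (_ , (() , _) , _)
triangle-only-cycle D v₀ (↑ _ ∷ _) _ (_ , (() , _) , _)
triangle-only-cycle D v₁ (v₂ ∷ v₀ ∷ _) _ (_ , _ , _ ∷ () ∷ _)
triangle-only-cycle D v₁ (v₂ ∷ []) _ (_ , (_ , () , _) , _)
triangle-only-cycle D v₁ (v₂ ∷ v₁ ∷ _) _ (_ , (_ , () , _) , _)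
triangle-only-cycle D v₁ (v₂ ∷ v₂ ∷ _) _ (_ , (_ , () , _) , _)
triangle-only-cycle D v₁ (v₂ ∷ ↑ _ ∷ _) _ (_ , (_ , () , _) , _)
triangle-only-cycle D v₁ [] _ (_ , (() , _) , _)
triangle-only-cycle D v₁ (v₀ ∷ _) _ (_ , (() , _) , _)
triangle-only-cycle D v₁ (v₁ ∷ _) _ (_ , (() , _) , _)
triangle-only-cycle D v₁ (↑ _ ∷ _) _ (_ , (() , _) , _)
triangle-only-cycle D v₂ (v₀ ∷ _) _ (_ , _ , () ∷ _)
triangle-only-cycle D v₂ [] _ (_ , (() , _) , _)
triangle-only-cycle D v₂ (v₁ ∷ _) _ (_ , (() , _) , _)
triangle-only-cycle D v₂ (v₂ ∷ _) _ (_ , (() , _) , _)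
triangle-only-cycle D v₂ (↑ _ ∷ _) _ (_ , (() , _) , _)

digon-only-cycle : ∀ D v rest → IsNew v → IsCycle (extend false D) (v ∷ rest) → v ∷ rest ≡ gadgetCycle false
digon-only-cycle D v₀ (v₁ ∷ []) _ _ = refl
digon-only-cycle D v₀ (v₁ ∷ v₀ ∷ _) _ ((_ ∷ v₀≢v₀ ∷ _) ∷ _ , _) = ⊥-elim (v₀≢v₀ refl)
digon-only-cycle D v₀ (v₁ ∷ v₁ ∷ _) _ (_ , (_ , () , _) , _)
digon-only-cycle D v₀ (v₁ ∷ v₂ ∷ _) _ (_ , (_ , () , _) , _)
digon-only-cycle D v₀ (v₁ ∷ ↑ _ ∷ _) _ (_ , (_ , () , _) , _)
digon-only-cycle D v₀ [] _ (_ , (() , _) , _)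
digon-only-cycle D v₀ (v₀ ∷ _) _ (_ , (() , _) , _)
digon-only-cycle D v₀ (v₂ ∷ _) _ (_ , (() , _) , _)
digon-only-cycle D v₀ (↑ _ ∷ _) _ (_ , (() , _) , _)
digon-only-cycle D v₁ (v₀ ∷ _) _ (_ , _ , () ∷ _)
digon-only-cycle D v₁ [] _ (_ , (() , _) , _)
digon-only-cycle D v₁ (v₁ ∷ _) _ (_ , (() , _) , _)
digon-only-cycle D v₁ (v₂ ∷ _) _ (_ , (() , _) , _)
digon-only-cycle D v₁ (↑ _ ∷ _) _ (_ , (() , _) , _)
digon-only-cycle D v₂ [] _ (_ , (() , _) , _)
digon-only-cycle D v₂ (v₀ ∷ _) _ (_ , (() , _) , _)
digon-only-cycle D v₂ (v₁ ∷ _) _ (_ , (() , _) , _)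
digon-only-cycle D v₂ (v₂ ∷ _) _ (_ , (() , _) , _)
digon-only-cycle D v₂ (↑ _ ∷ _) _ (_ , (() , _) , _)

gadget-only-cycle : ∀ b D v rest → IsNew v → IsCycle (extend b D) (v ∷ rest) → v ∷ rest ≡ gadgetCycle b
gadget-only-cycle true = triangle-only-cycle
gadget-only-cycle false = digon-only-cycle

extend-cycles-complete : ∀ b D (L : List (List (Fin (V D)))) → (∀ c → IsCycle D c → c ∈ L) →
  ∀ c → IsCycle (extend b D) c → c ∈ gadgetCycle b ∷ map (map ↑) L
extend-cycles-complete b D L complete (v₀ ∷ rest) cyc = here (gadget-only-cycle b D v₀ rest tt cyc)
extend-cycles-complete b D L complete (v₁ ∷ rest) cyc = here (gadget-only-cycle b D v₁ rest tt cyc)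
extend-cycles-complete b D L complete (v₂ ∷ rest) cyc = here (gadget-only-cycle b D v₂ rest tt cyc)
extend-cycles-complete b D L complete (↑ u ∷ rest) cyc@(_ , walk , _)
  with All-IsOld⇒map-↑ b D rest (All.++⁻ˡ rest (Walk-from-old b D u (rest ++ [ ↑ u ]) walk))
... | rest′ , refl = there (∈-map⁺ (map ↑) (complete (u ∷ rest′) (IsCycle-↑⁻ b D u rest′ cyc)))

cic-extend : ∀ b D m → CicIs D m → CicIs (extend b D) (suc m)
cic-extend b D m (L , unique , cycles , complete , length≡m) =
  gadgetCycle b ∷ map (map ↑) L ,
  All.map⁺ (All.map (λ {c} _ → gadgetCycle≢map-↑ b c) cycles) ∷ Unique.map⁺ (map-injective ↑-injective) unique ,
  gadgetCycle-isCycle b D ∷ All.map⁺ (All.map (λ {c} → IsCycle-↑⁺ b D c) cycles) ,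
  extend-cycles-complete b D L complete ,
  cong suc (trans (length-map (map ↑) L) length≡m)

cic-empty : CicIs emptyDigraph 0
cic-empty = [] , [] , [] , (λ { (() ∷ _) _ }) , refl

ind : Bool → ℕ
ind b = if b then 1 else 0

sumFin : ∀ {n} → (Fin n → ℕ) → ℕ
sumFin f = sum (tabulate f)

sumFin-cong : ∀ {n} {f g : Fin n → ℕ} → (∀ i → f i ≡ g i) → sumFin f ≡ sumFin g
sumFin-cong f≗g = cong sum (tabulate-cong f≗g)

sumFin-mono : ∀ {n} {f g : Fin n → ℕ} → (∀ i → f i ≤ g i) → sumFin f ≤ sumFin g
sumFin-mono {zero} f≤g = z≤n
sumFin-mono {suc n} f≤g = +-mono-≤ (f≤g zero) (sumFin-mono (λ i → f≤g (suc i)))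

sumFin-zero : ∀ n → sumFin {n} (λ _ → 0) ≡ 0
sumFin-zero zero = refl
sumFin-zero (suc n) = sumFin-zero n

term≤sumFin : ∀ {n} (f : Fin n → ℕ) i → f i ≤ sumFin f
term≤sumFin f zero = m≤m+n (f zero) _
term≤sumFin f (suc i) = ≤-trans (term≤sumFin (λ j → f (suc j)) i) (m≤n+m _ (f zero))

sumFin-↑≤sumFin : ∀ {n} (f : Fin (3 + n) → ℕ) → sumFin (λ i → f (↑ i)) ≤ sumFin f
sumFin-↑≤sumFin f = ≤-trans (m≤n+m _ (f v₂)) (≤-trans (m≤n+m _ (f v₁)) (m≤n+m _ (f v₀)))

rowCount : ∀ {n} → (Fin n → Fin n → Bool) → Fin n → ℕ
rowCount Λ u = sumFin (λ v → ind (Λ u v))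

one≤rowCount : ∀ {n} (Λ : Fin n → Fin n → Bool) {u v} → Λ u v ≡ true → 1 ≤ rowCount Λ u
one≤rowCount Λ {u} {v} Λuv = subst (λ x → ind x ≤ rowCount Λ u) Λuv (term≤sumFin (λ w → ind (Λ u w)) v)

card≡sumFin-rowCount : ∀ {D} (Λ : ArcSubset D) → card {D} Λ ≡ sumFin (rowCount Λ)
card≡sumFin-rowCount {D} Λ =
  trans (cong sum (map-tabulate {n = V D} id _)) (sumFin-cong {V D} (λ u → cong sum (map-tabulate {n = V D} id _)))

restrict : ∀ {n} → (Fin (3 + n) → Fin (3 + n) → Bool) → Fin n → Fin n → Bool
restrict Λ u v = Λ (↑ u) (↑ v)

restrict-⊆ : ∀ b D {Λ : ArcSubset (extend b D)} → SubsetOfArcs (extend b D) Λ → SubsetOfArcs D (restrict Λ)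
restrict-⊆ b D Λ⊆ u v = Λ⊆ (↑ u) (↑ v)

gadgetCount : ∀ {n} → (Fin (3 + n) → Fin (3 + n) → Bool) → ℕ
gadgetCount Λ = rowCount Λ v₀ + (rowCount Λ v₁ + rowCount Λ v₂)

gadgetCount+card-restrict≤card : ∀ b D (Λ : ArcSubset (extend b D)) →
  gadgetCount Λ + card {D} (restrict Λ) ≤ card {extend b D} Λ
gadgetCount+card-restrict≤card b D Λ = begin
  gadgetCount Λ + card {D} (restrict Λ)
    ≡⟨ cong (gadgetCount Λ +_) (card≡sumFin-rowCount {D} (restrict Λ)) ⟩
  gadgetCount Λ + sumFin (rowCount (restrict Λ))
    ≤⟨ +-monoʳ-≤ (gadgetCount Λ) (sumFin-mono (λ u → sumFin-↑≤sumFin (λ v → ind (Λ (↑ u) v)))) ⟩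
  r v₀ + (r v₁ + r v₂) + old
    ≡⟨ trans (+-assoc (r v₀) _ old) (cong (r v₀ +_) (+-assoc (r v₁) (r v₂) old)) ⟩
  sumFin r
    ≡⟨ sym (card≡sumFin-rowCount {extend b D} Λ) ⟩
  card {extend b D} Λ ∎
  where
  open ≤-Reasoning
  r : Fin (3 + V D) → ℕ
  r = rowCount Λ
  old : ℕ
  old = sumFin (λ u → r (↑ u))

-- Λ together with the arc v₂ → v₀ of the triangle, if there is one.
extendΛ : ∀ {n} → Bool → (Fin n → Fin n → Bool) → Fin (3 + n) → Fin (3 + n) → Bool
extendΛ b Λ v₂ v₀ = b
extendΛ b Λ (↑ u) (↑ v) = Λ u v
extendΛ b Λ _ _ = false

extendΛ-⊆ : ∀ b D {Λ : ArcSubset D} → SubsetOfArcs D Λ → SubsetOfArcs (extend b D) (extendΛ b Λ)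
extendΛ-⊆ b D Λ⊆ v₂ v₀ b≡true = b≡true
extendΛ-⊆ b D Λ⊆ (↑ u) (↑ v) Λuv = Λ⊆ u v Λuv
extendΛ-⊆ b D Λ⊆ v₀ v ()
extendΛ-⊆ b D Λ⊆ v₁ v ()
extendΛ-⊆ b D Λ⊆ v₂ v₁ ()
extendΛ-⊆ b D Λ⊆ v₂ v₂ ()
extendΛ-⊆ b D Λ⊆ v₂ (↑ v) ()
extendΛ-⊆ b D Λ⊆ (↑ u) v₀ ()
extendΛ-⊆ b D Λ⊆ (↑ u) v₁ ()
extendΛ-⊆ b D Λ⊆ (↑ u) v₂ ()

card-extendΛ : ∀ b D (Λ : ArcSubset D) → card {extend b D} (extendΛ b Λ) ≡ ind b + card {D} Λ
card-extendΛ b D Λ = begin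
  card {extend b D} (extendΛ b Λ)              ≡⟨ card≡sumFin-rowCount {extend b D} (extendΛ b Λ) ⟩
  zeros + (zeros + ((ind b + zeros) + rows))   ≡⟨ cong (λ z → z + (z + ((ind b + z) + rows))) (sumFin-zero (V D)) ⟩
  (ind b + 0) + rows                           ≡⟨ cong (_+ rows) (+-identityʳ (ind b)) ⟩
  ind b + rows                                 ≡⟨ cong (ind b +_) (sym (card≡sumFin-rowCount {D} Λ)) ⟩
  ind b + card {D} Λ                           ∎
  where
  open ≡-Reasoning
  zeros rows : ℕ
  zeros = sumFin {V D} (λ _ → 0)
  rows = sumFin (rowCount Λ)

SubArc-v₁-v₀⊎v₂ : ∀ b D (Λ : ArcSubset D) →
  SubArc (extend b D) (extendΛ b Λ) (inj₁ v₁) (inj₁ v₀) ⊎ SubArc (extend b D) (extendΛ b Λ) (inj₁ v₁) (inj₁ v₂)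
SubArc-v₁-v₀⊎v₂ true D Λ = inj₂ (refl , refl)
SubArc-v₁-v₀⊎v₂ false D Λ = inj₁ (refl , refl)

module _ (b : Bool) (D : Digraph) where

  ↑ˢ : {Λ : ArcSubset (extend b D)} → SubVertex D (restrict Λ) → SubVertex (extend b D) Λ
  ↑ˢ (inj₁ u) = inj₁ (↑ u)
  ↑ˢ (inj₂ ((u , v) , p)) = inj₂ ((↑ u , ↑ v) , p)

  SubArc-↑ˢ : ∀ {Λ} x y → SubArc D (restrict Λ) x y → SubArc (extend b D) Λ (↑ˢ x) (↑ˢ y)
  SubArc-↑ˢ (inj₁ u) (inj₁ v) uv = uv
  SubArc-↑ˢ (inj₁ u) (inj₂ _) u≡u′ = cong ↑ u≡u′
  SubArc-↑ˢ (inj₂ _) (inj₁ w) v≡w = cong ↑ v≡w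

  SubArc-from-↑ˢ : ∀ {Λ} → SubsetOfArcs (extend b D) Λ → ∀ x y → SubArc (extend b D) Λ (↑ˢ x) y →
    Σ[ y′ ∈ SubVertex D (restrict Λ) ] (y ≡ ↑ˢ y′ × SubArc D (restrict Λ) x y′)
  SubArc-from-↑ˢ Λ⊆ (inj₁ u) (inj₁ (↑ w)) uw = inj₁ w , refl , uw
  SubArc-from-↑ˢ Λ⊆ (inj₁ u) (inj₁ v₀) (() , _)
  SubArc-from-↑ˢ Λ⊆ (inj₁ u) (inj₁ v₁) (() , _)
  SubArc-from-↑ˢ Λ⊆ (inj₁ u) (inj₁ v₂) (() , _)
  SubArc-from-↑ˢ Λ⊆ (inj₁ u) (inj₂ ((_ , ↑ w) , p)) refl = inj₂ ((u , w) , p) , refl , refl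
  SubArc-from-↑ˢ Λ⊆ (inj₁ u) (inj₂ ((_ , v₀) , p)) refl with Λ⊆ (↑ u) v₀ p
  ... | ()
  SubArc-from-↑ˢ Λ⊆ (inj₁ u) (inj₂ ((_ , v₁) , p)) refl with Λ⊆ (↑ u) v₁ p
  ... | ()
  SubArc-from-↑ˢ Λ⊆ (inj₁ u) (inj₂ ((_ , v₂) , p)) refl with Λ⊆ (↑ u) v₂ p
  ... | ()
  SubArc-from-↑ˢ Λ⊆ (inj₂ ((_ , w) , _)) (inj₁ _) refl = inj₁ w , refl , refl

  HasKernel-restrict : ∀ {Λ} → SubsetOfArcs (extend b D) Λ → HasKernel (SubArc (extend b D) Λ) →
    HasKernel (SubArc D (restrict Λ))
  HasKernel-restrict Λ⊆ (N , independent , absorbent) =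
    (λ x → N (↑ˢ x)) , (λ x y Nx Ny xy → independent (↑ˢ x) (↑ˢ y) Nx Ny (SubArc-↑ˢ x y xy)) , absorbent′
    where
    absorbent′ : ∀ x → N (↑ˢ x) ≡ false → Σ[ y ∈ _ ] (N (↑ˢ y) ≡ true × SubArc D _ x y)
    absorbent′ x Nx with absorbent (↑ˢ x) Nx
    ... | y , Ny , xy with SubArc-from-↑ˢ Λ⊆ x y xy
    ... | y′ , refl , xy′ = y′ , Ny , xy′

  HasKernel-extend : ∀ {Λ} → SubsetOfArcs D Λ → HasKernel (SubArc D Λ) → HasKernel (SubArc (extend b D) (extendΛ b Λ))
  HasKernel-extend {Λ} Λ⊆ (N , independent , absorbent) = N′ , independent′ , absorbent′
    where
    Λ′ : ArcSubset (extend b D)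
    Λ′ = extendΛ b Λ

    N′ : SubVertex (extend b D) Λ′ → Bool
    N′ (inj₁ v₀) = true
    N′ (inj₁ v₁) = false
    N′ (inj₁ v₂) = true
    N′ (inj₁ (↑ u)) = N (inj₁ u)
    N′ (inj₂ ((↑ u , ↑ v) , p)) = N (inj₂ ((u , v) , p))
    N′ (inj₂ _) = false

    N′-↑ˢ : ∀ x → N′ (↑ˢ x) ≡ N x
    N′-↑ˢ (inj₁ _) = refl
    N′-↑ˢ (inj₂ _) = refl

    independent-old : ∀ x y → N x ≡ true → N′ y ≡ true → ¬ SubArc (extend b D) Λ′ (↑ˢ x) y
    independent-old x y Nx Ny xy with SubArc-from-↑ˢ (extendΛ-⊆ b D Λ⊆) x y xy
    ... | y′ , refl , xy′ = independent x y′ Nx (trans (sym (N′-↑ˢ y′)) Ny) xy′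

    independent′ : ∀ x y → N′ x ≡ true → N′ y ≡ true → ¬ SubArc (extend b D) Λ′ x y
    independent′ (inj₁ v₀) (inj₁ v₀) _ _ (() , _)
    independent′ (inj₁ v₀) (inj₁ v₁) _ () _
    independent′ (inj₁ v₀) (inj₁ v₂) _ _ (() , _)
    independent′ (inj₁ v₀) (inj₁ (↑ _)) _ _ (() , _)
    independent′ (inj₁ v₀) (inj₂ _) _ () refl
    independent′ (inj₁ v₁) _ ()
    independent′ (inj₁ v₂) (inj₁ v₀) _ _ (b≡true , b≡false) with trans (sym b≡false) b≡true
    ... | ()
    independent′ (inj₁ v₂) (inj₁ v₁) _ () _
    independent′ (inj₁ v₂) (inj₁ v₂) _ _ (() , _)
    independent′ (inj₁ v₂) (inj₁ (↑ _)) _ _ (() , _)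
    independent′ (inj₁ v₂) (inj₂ _) _ () refl
    independent′ (inj₁ (↑ u)) y = independent-old (inj₁ u) y
    independent′ (inj₂ ((↑ u , ↑ v) , p)) y = independent-old (inj₂ ((u , v) , p)) y
    independent′ (inj₂ ((v₀ , _) , _)) _ ()
    independent′ (inj₂ ((v₁ , _) , _)) _ ()
    independent′ (inj₂ ((v₂ , _) , _)) _ ()
    independent′ (inj₂ ((↑ _ , v₀) , _)) _ ()
    independent′ (inj₂ ((↑ _ , v₁) , _)) _ ()
    independent′ (inj₂ ((↑ _ , v₂) , _)) _ ()

    absorbent-old : ∀ x → N x ≡ false → Σ[ y ∈ _ ] (N′ y ≡ true × SubArc (extend b D) Λ′ (↑ˢ x) y)
    absorbent-old x Nx with absorbent x Nx
    ... | y , Ny , xy = ↑ˢ y , trans (N′-↑ˢ y) Ny , SubArc-↑ˢ x y xy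

    absorbent′ : ∀ x → N′ x ≡ false → Σ[ y ∈ _ ] (N′ y ≡ true × SubArc (extend b D) Λ′ x y)
    absorbent′ (inj₁ v₀) ()
    absorbent′ (inj₁ v₁) _ with SubArc-v₁-v₀⊎v₂ b D Λ
    ... | inj₁ v₁v₀ = inj₁ v₀ , refl , v₁v₀
    ... | inj₂ v₁v₂ = inj₁ v₂ , refl , v₁v₂
    absorbent′ (inj₁ v₂) ()
    absorbent′ (inj₁ (↑ u)) = absorbent-old (inj₁ u)
    absorbent′ (inj₂ ((↑ u , ↑ v) , p)) = absorbent-old (inj₂ ((u , v) , p))
    absorbent′ (inj₂ ((v₂ , v₀) , _)) _ = inj₁ v₀ , refl , refl
    absorbent′ (inj₂ ((v₀ , _) , ()))
    absorbent′ (inj₂ ((v₁ , _) , ()))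
    absorbent′ (inj₂ ((v₂ , v₁) , ()))
    absorbent′ (inj₂ ((v₂ , v₂) , ()))
    absorbent′ (inj₂ ((v₂ , ↑ _) , ()))
    absorbent′ (inj₂ ((↑ _ , v₀) , ()))
    absorbent′ (inj₂ ((↑ _ , v₁) , ()))
    absorbent′ (inj₂ ((↑ _ , v₂) , ()))

absorber-unique : ∀ D (Λ : ArcSubset D) → SubsetOfArcs D Λ → ∀ {u v y} →
  (∀ w → arc D u w ≡ true → w ≡ v) → Λ u v ≡ false → SubArc D Λ (inj₁ u) y → y ≡ inj₁ v
absorber-unique D Λ Λ⊆ {y = inj₁ w} out _ (uw , _) = cong inj₁ (out w uw)
absorber-unique D Λ Λ⊆ {u} {v} {inj₂ ((_ , w) , p)} out Λuv≡false refl with out w (Λ⊆ u w p)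
... | refl with trans (sym Λuv≡false) p
... | ()

triangle-subdivided : ∀ D (Λ : ArcSubset (extend true D)) → SubsetOfArcs (extend true D) Λ →
  HasKernel (SubArc (extend true D) Λ) → Λ v₀ v₁ ≡ true ⊎ Λ v₁ v₂ ≡ true ⊎ Λ v₂ v₀ ≡ true
triangle-subdivided D Λ Λ⊆ (N , independent , absorbent) with Λ v₀ v₁ in e₀₁ | Λ v₁ v₂ in e₁₂ | Λ v₂ v₀ in e₂₀
... | true | _ | _ = inj₁ refl
... | false | true | _ = inj₂ (inj₁ refl)
... | false | false | true = inj₂ (inj₂ refl)
... | false | false | false = ⊥-elim odd-cycle
  where
  absorbed-by-successor : ∀ {u v} → (∀ w → arc (extend true D) u w ≡ true → w ≡ v) → Λ u v ≡ false →
    N (inj₁ u) ≡ false → N (inj₁ v) ≡ true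
  absorbed-by-successor {u} out Λuv Nu with absorbent (inj₁ u) Nu
  ... | y , Ny , uy with absorber-unique (extend true D) Λ Λ⊆ out Λuv uy
  ... | refl = Ny

  successor₀ : ∀ w → arc (extend true D) v₀ w ≡ true → w ≡ v₁
  successor₀ v₁ _ = refl
  successor₀ v₀ ()
  successor₀ v₂ ()
  successor₀ (↑ _) ()

  successor₁ : ∀ w → arc (extend true D) v₁ w ≡ true → w ≡ v₂
  successor₁ v₂ _ = refl
  successor₁ v₀ ()
  successor₁ v₁ ()
  successor₁ (↑ _) ()

  successor₂ : ∀ w → arc (extend true D) v₂ w ≡ true → w ≡ v₀
  successor₂ v₀ _ = refl
  successor₂ v₁ ()
  successor₂ v₂ ()
  successor₂ (↑ _) ()

  odd-cycle : ⊥
  odd-cycle with N (inj₁ v₀) in n₀ | N (inj₁ v₁) in n₁ | N (inj₁ v₂) in n₂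
  ... | true | true | _ = independent (inj₁ v₀) (inj₁ v₁) n₀ n₁ (refl , e₀₁)
  ... | true | false | _ = independent (inj₁ v₂) (inj₁ v₀) (absorbed-by-successor successor₁ e₁₂ n₁) n₀ (refl , e₂₀)
  ... | false | _ | true = independent (inj₁ v₁) (inj₁ v₂) (absorbed-by-successor successor₀ e₀₁ n₀) n₂ (refl , e₁₂)
  ... | false | _ | false with trans (sym n₀) (absorbed-by-successor successor₂ e₂₀ n₂)
  ... | ()

ind≤gadgetCount : ∀ b D (Λ : ArcSubset (extend b D)) → SubsetOfArcs (extend b D) Λ →
  HasKernel (SubArc (extend b D) Λ) → ind b ≤ gadgetCount Λ
ind≤gadgetCount false D Λ _ _ = z≤n
ind≤gadgetCount true D Λ Λ⊆ kernel with triangle-subdivided D Λ Λ⊆ kernel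
... | inj₁ Λ₀₁ = ≤-trans (one≤rowCount Λ Λ₀₁) (m≤m+n _ _)
... | inj₂ (inj₁ Λ₁₂) = ≤-trans (one≤rowCount Λ Λ₁₂) (≤-trans (m≤m+n _ (rowCount Λ v₂)) (m≤n+m _ (rowCount Λ v₀)))
... | inj₂ (inj₂ Λ₂₀) = ≤-trans (one≤rowCount Λ Λ₂₀) (≤-trans (m≤n+m _ (rowCount Λ v₁)) (m≤n+m _ (rowCount Λ v₀)))

kappa-extend : ∀ b D κ → KappaIs D κ → KappaIs (extend b D) (ind b + κ)
kappa-extend b D κ ((Λ , Λ⊆ , card≡κ , kernel) , minimal) =
  (extendΛ b Λ , extendΛ-⊆ b D Λ⊆ , trans (card-extendΛ b D Λ) (cong (ind b +_) card≡κ) , HasKernel-extend b D Λ⊆ kernel) ,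
  λ Λ′ Λ′⊆ kernel′ → begin
    ind b + κ
      ≤⟨ +-mono-≤ (ind≤gadgetCount b D Λ′ Λ′⊆ kernel′)
                  (minimal (restrict Λ′) (restrict-⊆ b D Λ′⊆) (HasKernel-restrict b D Λ′⊆ kernel′)) ⟩
    gadgetCount Λ′ + card {D} (restrict Λ′)
      ≤⟨ gadgetCount+card-restrict≤card b D Λ′ ⟩
    card {extend b D} Λ′ ∎
  where open ≤-Reasoning

kappa-empty : KappaIs emptyDigraph 0
kappa-empty = ((λ ()) , (λ ()) , refl , (λ _ → false) , (λ { (inj₁ ()) ; (inj₂ ((() , _) , _)) }) , (λ { (inj₁ ()) ; (inj₂ ((() , _) , _)) })) ,
  (λ _ _ _ → z≤n)

cic-gadgets : ∀ t k → CicIs (gadgets t k) (t + k)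
cic-gadgets zero zero = cic-empty
cic-gadgets zero (suc k) = cic-extend false (gadgets zero k) k (cic-gadgets zero k)
cic-gadgets (suc t) k = cic-extend true (gadgets t k) (t + k) (cic-gadgets t k)

kappa-gadgets : ∀ t k → KappaIs (gadgets t k) t
kappa-gadgets zero zero = kappa-empty
kappa-gadgets zero (suc k) = kappa-extend false (gadgets zero k) 0 (kappa-gadgets zero k)
kappa-gadgets (suc t) k = kappa-extend true (gadgets t k) t (kappa-gadgets t k)

mainTheorem6 : (n m : ℕ) → n ≤ m → Σ[ G ∈ Digraph ] (CicIs G m × KappaIs G n)
mainTheorem6 n m n≤m =
  gadgets n (m ∸ n) , subst (CicIs (gadgets n (m ∸ n))) (m+[n∸m]≡n n≤m) (cic-gadgets n (m ∸ n)) , kappa-gadgets n (m ∸ n)
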